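{- Let $k\geq 0$ be an integer and let $G$ be a $k$-degenerate graph (with at least one vertex). For every integer $p\geq k+1$, $\mathrm{id}^{\leq p}(G) \leq |V(G)|-1$.
   Context: All graphs are finite and simple. A graph is $k$-degenerate if its vertices admit an ordering $(v_1,\dots,v_n)$ such that each $v_i$ has at most $k$ neighbours in $\{v_{i+1},\dots,v_n\}$. In an oriented graph, the inversion of a vertex set $X$ reverses the orientation of every arc with both endvertices in $X$; a $(\leq p)$-inversion is the inversion of a set of at most $p$ vertices. For a graph $G$ with labelled vertices, $\mathrm{id}^{\leq p}(G)$ is the maximum, over all pairs of orientations $\vec G_1,\vec G_2$ of $G$, of the minimum number of $(\leq p)$-inversions transforming $\vec G_1$ into $\vec G_2$. -}

module Defs where

open import Data.Nat using (ℕ; suc; _≤_; _<ᵇ_)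
open import Data.Bool using (Bool; true; false; if_then_else_; _∧_)
open import Data.Fin using (Fin; toℕ)
open import Data.Fin.Subset using (Subset; ∣_∣; _∈_)
open import Data.Fin.Permutation using (Permutation′; _⟨$⟩ʳ_)
open import Data.Vec using (tabulate; lookup)
open import Data.List using (List; []; _∷_; length; foldl)
open import Data.List.Relation.Unary.All using (All)
open import Data.Product using (Σ; _×_)
open import Relation.Binary.PropositionalEquality using (_≡_)

record Graph (n : ℕ) : Set where
  field
    adj   : Fin n → Fin n → Bool
    sym   : ∀ u v → adj u v ≡ adj v u
    irrefl : ∀ u → adj u u ≡ false
open Graph public

-- An oriented graph on Fin n as a Boolean arc relation (arc u v = true
-- means there is an arc from u to v).
ArcRel : ℕ → Set
ArcRel n = Fin n → Fin n → Bool

IsOrientation : ∀ {n} → Graph n → ArcRel n → Set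
IsOrientation G D =
  ∀ u v → (adj G u v ≡ false → D u v ≡ false)
        × (adj G u v ≡ true → (D u v ≡ true → D v u ≡ false)
                             × (D u v ≡ false → D v u ≡ true))

invert : ∀ {n} → Subset n → ArcRel n → ArcRel n
invert X D u v = if lookup X u ∧ lookup X v then D v u else D u v

invertAll : ∀ {n} → List (Subset n) → ArcRel n → ArcRel n
invertAll Xs D = foldl (λ E X → invert X E) D Xs

TransformsWithin : ∀ {n} → ℕ → ℕ → ArcRel n → ArcRel n → Set
TransformsWithin {n} p m D₁ D₂ =
  Σ (List (Subset n)) λ Xs →
    (length Xs ≤ m) × All (λ X → ∣ X ∣ ≤ p) Xs
    × (∀ u v → invertAll Xs D₁ u v ≡ D₂ u v)

-- id^{≤p}(G) ≤ m : for every pair of orientations, at most m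
-- (≤ p)-inversions suffice to go from the first to the second.
IdLe : ∀ {n} → Graph n → ℕ → ℕ → Set
IdLe G p m = ∀ D₁ D₂ → IsOrientation G D₁ → IsOrientation G D₂
  → TransformsWithin p m D₁ D₂

laterNeighbours : ∀ {n} → Graph n → Permutation′ n → Fin n → ℕ
laterNeighbours G σ i = ∣ tabulate (λ j → (toℕ i <ᵇ toℕ j) ∧ adj G (σ ⟨$⟩ʳ i) (σ ⟨$⟩ʳ j)) ∣

Degenerate : ∀ {n} → ℕ → Graph n → Set
Degenerate {n} k G =
  Σ (Permutation′ n) λ σ → ∀ i → laterNeighbours G σ i ≤ k

module Submission where

-- Process the vertices in a degeneracy order v₀, …, vₙ.  At step i invert
-- {vᵢ} together with those later neighbours w of vᵢ for which the edge vᵢw is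
-- oriented differently in the current orientation and in the target; this set
-- has at most k + 1 ≤ p elements.  The inversion fixes every arc between vᵢ
-- and a later vertex and touches no arc at an earlier vertex, so after steps
-- 0, …, n − 1 only arcs inside {vₙ} could still differ, and there are none.

open import Defs hiding (sym)
open import Data.Nat using (ℕ; zero; suc; _≤_; _<_; _+_; _≡ᵇ_; _<ᵇ_; z≤n; s≤s; s≤s⁻¹)
open import Data.Nat.Properties
open import Data.Bool using (Bool; true; false; not; _∧_; _∨_; _xor_; if_then_else_)
open import Data.Bool.Properties using (∧-zeroʳ)
open import Data.Fin as Fin using (Fin; toℕ; fromℕ<)
open import Data.Fin.Properties using (toℕ-injective; toℕ<n; toℕ-fromℕ<)
open import Data.Fin.Subset using (Subset; ∣_∣)
open import Data.Fin.Permutation using (Permutation′; _⟨$⟩ʳ_; _⟨$⟩ˡ_; inverseˡ; inverseʳ)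
open import Data.Vec using (tabulate; lookup)
open import Data.Vec.Properties using (lookup∘tabulate)
open import Data.List using ([]; _∷_)
open import Data.List.Relation.Unary.All using ([]; _∷_)
open import Data.Product using (_,_; proj₁; proj₂)
open import Data.Sum using (inj₁; inj₂)
open import Function using (_∘_)
open import Relation.Nullary using (¬_; yes; no)
open import Relation.Nullary.Decidable using (dec-true; dec-false)
open import Relation.Binary using (tri<; tri≈; tri>)
open import Relation.Binary.PropositionalEquality
open import Algebra.Properties.CommutativeMonoid.Sum +-0-commutativeMonoid
  using (sum; sum-permute; sum-cong-≗; sum-replicate-zero; ∑-distrib-+)

𝟙 : Bool → ℕ
𝟙 true  = 1
𝟙 false = 0

𝟙-∨-∧-≤ : ∀ a b c → 𝟙 (a ∨ (b ∧ c)) ≤ 𝟙 a + 𝟙 b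
𝟙-∨-∧-≤ true  b     c     = s≤s z≤n
𝟙-∨-∧-≤ false false c     = z≤n
𝟙-∨-∧-≤ false true  false = z≤n
𝟙-∨-∧-≤ false true  true  = ≤-refl

∣tabulate∣≡∑𝟙 : ∀ {n} (f : Fin n → Bool) → ∣ tabulate f ∣ ≡ sum (𝟙 ∘ f)
∣tabulate∣≡∑𝟙 {zero}  f = refl
∣tabulate∣≡∑𝟙 {suc n} f with f Fin.zero
... | true  = cong suc (∣tabulate∣≡∑𝟙 (f ∘ Fin.suc))
... | false = ∣tabulate∣≡∑𝟙 (f ∘ Fin.suc)

∑-mono-≤ : ∀ {n} {f g : Fin n → ℕ} → (∀ j → f j ≤ g j) → sum f ≤ sum g
∑-mono-≤ {zero}  f≤g = z≤n
∑-mono-≤ {suc n} f≤g = +-mono-≤ (f≤g Fin.zero) (∑-mono-≤ (f≤g ∘ Fin.suc))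

∑𝟙[toℕ≡ᵇ]≤1 : ∀ {n} m → sum {n} (λ j → 𝟙 (toℕ j ≡ᵇ m)) ≤ 1
∑𝟙[toℕ≡ᵇ]≤1 {zero}  m       = z≤n
∑𝟙[toℕ≡ᵇ]≤1 {suc n} zero    = ≤-reflexive (cong suc (sum-replicate-zero n))
∑𝟙[toℕ≡ᵇ]≤1 {suc n} (suc m) = ∑𝟙[toℕ≡ᵇ]≤1 {n} m

if-xor-then-not : ∀ a b → (if a xor b then not a else a) ≡ b
if-xor-then-not true  true  = refl
if-xor-then-not true  false = refl
if-xor-then-not false true  = refl
if-xor-then-not false false = refl

-- IsOrientation G D as a single equation: the arc v → u is present exactly
-- when uv is an edge that is not oriented u → v.
Oriented : ∀ {n} → Graph n → ArcRel n → Set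
Oriented G D = ∀ u v → D v u ≡ adj G u v ∧ not (D u v)

module Orientations {n} (G : Graph n) where

  isOrientation⇒oriented : ∀ {D} → IsOrientation G D → Oriented G D
  isOrientation⇒oriented {D} o u v with adj G u v in uv | D u v in duv
  ... | false | _     = proj₁ (o v u) (trans (Graph.sym G v u) uv)
  ... | true  | true  = proj₁ (proj₂ (o u v) uv) duv
  ... | true  | false = proj₂ (proj₂ (o u v) uv) duv

  invert-oriented : ∀ {D} (X : Subset n) → Oriented G D → Oriented G (invert X D)
  invert-oriented {D} X o u v with lookup X u | lookup X v
  ... | true  | true  = trans (o v u) (cong (λ b → b ∧ not (D v u)) (Graph.sym G v u))
  ... | true  | false = o u v
  ... | false | true  = o u v
  ... | false | false = o u v

  oriented-reverse-edge : ∀ {D u v} → Oriented G D → adj G u v ≡ true → D v u ≡ not (D u v)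
  oriented-reverse-edge {D} {u} {v} o uv = trans (o u v) (cong (_∧ not (D u v)) uv)

  module _ {D D′ : ArcRel n} (o : Oriented G D) (o′ : Oriented G D′) where

    oriented-≡-reverse : ∀ {u v} → D u v ≡ D′ u v → D v u ≡ D′ v u
    oriented-≡-reverse {u} {v} eq =
      trans (o u v) (trans (cong (λ b → adj G u v ∧ not b) eq) (sym (o′ u v)))

    oriented-≡-non-edge : ∀ {u v} → adj G u v ≡ false → D u v ≡ D′ u v
    oriented-≡-non-edge {u} {v} uv = begin
      D u v                      ≡⟨ o v u ⟩
      adj G v u ∧ not (D v u)    ≡⟨ cong (_∧ not (D v u)) (trans (Graph.sym G v u) uv) ⟩
      false                      ≡⟨ cong (_∧ not (D′ v u)) (trans (Graph.sym G v u) uv) ⟨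
      adj G v u ∧ not (D′ v u)   ≡⟨ o′ v u ⟨
      D′ u v                     ∎
      where open ≡-Reasoning

    oriented-≡-diagonal : ∀ u → D u u ≡ D′ u u
    oriented-≡-diagonal u = oriented-≡-non-edge (Graph.irrefl G u)

invert-outsideˡ : ∀ {n} (X : Subset n) (D : ArcRel n) {u v} →
                  lookup X u ≡ false → invert X D u v ≡ D u v
invert-outsideˡ X D u∉X rewrite u∉X = refl

invert-outsideʳ : ∀ {n} (X : Subset n) (D : ArcRel n) {u v} →
                  lookup X v ≡ false → invert X D u v ≡ D u v
invert-outsideʳ X D {u} v∉X rewrite v∉X | ∧-zeroʳ (lookup X u) = refl

invert-insideˡ : ∀ {n} (X : Subset n) (D : ArcRel n) {u v} → lookup X u ≡ true →
                 invert X D u v ≡ (if lookup X v then D v u else D u v)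
invert-insideˡ X D u∈X rewrite u∈X = refl

invert-∷ : ∀ {n p r} (X : Subset n) {D D′ : ArcRel n} → ∣ X ∣ ≤ p →
           TransformsWithin p r (invert X D) D′ → TransformsWithin p (suc r) D D′
invert-∷ X ∣X∣≤p (Xs , length≤r , small , same) = X ∷ Xs , s≤s length≤r , ∣X∣≤p ∷ small , same

module Greedy {n} (G : Graph (suc n)) (σ : Permutation′ (suc n))
              (D₂ : ArcRel (suc n)) (o₂ : Oriented G D₂) where

  open Orientations G

  pos : Fin (suc n) → ℕ
  pos w = toℕ (σ ⟨$⟩ˡ w)

  pos-σ : ∀ j → pos (σ ⟨$⟩ʳ j) ≡ toℕ j
  pos-σ j = cong toℕ (inverseˡ σ)

  pos-injective : ∀ {u v} → pos u ≡ pos v → u ≡ v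
  pos-injective {u} {v} eq = begin
    u                   ≡⟨ inverseʳ σ ⟨
    σ ⟨$⟩ʳ (σ ⟨$⟩ˡ u)   ≡⟨ cong (σ ⟨$⟩ʳ_) (toℕ-injective eq) ⟩
    σ ⟨$⟩ʳ (σ ⟨$⟩ˡ v)   ≡⟨ inverseʳ σ ⟩
    v                   ∎
    where open ≡-Reasoning

  AgreesOnFirst : ℕ → ArcRel (suc n) → Set
  AgreesOnFirst m D = ∀ u v → pos u < m → D u v ≡ D₂ u v

  agreesOnFirst-reverse : ∀ {m D u v} → Oriented G D → AgreesOnFirst m D →
                          pos v < m → D u v ≡ D₂ u v
  agreesOnFirst-reverse {u = u} {v} o agr v<m = oriented-≡-reverse o o₂ (agr v u v<m)

  module Step (i : Fin (suc n)) {D : ArcRel (suc n)} (o : Oriented G D)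
              (agr : AgreesOnFirst (toℕ i) D) where

    m : ℕ
    m = toℕ i

    c : Fin (suc n)
    c = σ ⟨$⟩ʳ i

    differs : Fin (suc n) → Bool
    differs w = D c w xor D₂ c w

    inX : Fin (suc n) → Bool
    inX w = (pos w ≡ᵇ m) ∨ (((m <ᵇ pos w) ∧ adj G c w) ∧ differs w)

    X : Subset (suc n)
    X = tabulate inX

    E : ArcRel (suc n)
    E = invert X D

    ∣X∣≤1+laterNeighbours : ∣ X ∣ ≤ suc (laterNeighbours G σ i)
    ∣X∣≤1+laterNeighbours = begin
      ∣ X ∣
        ≡⟨ ∣tabulate∣≡∑𝟙 inX ⟩
      sum (𝟙 ∘ inX)
        ≡⟨ sum-permute (𝟙 ∘ inX) σ ⟩
      sum (𝟙 ∘ inX ∘ (σ ⟨$⟩ʳ_))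
        ≡⟨ sum-cong-≗ (cong 𝟙 ∘ inX-σ) ⟩
      sum (λ j → 𝟙 (atI j ∨ (laterNeighbour j ∧ δ j)))
        ≤⟨ ∑-mono-≤ (λ j → 𝟙-∨-∧-≤ (atI j) (laterNeighbour j) (δ j)) ⟩
      sum (λ j → 𝟙 (atI j) + 𝟙 (laterNeighbour j))
        ≡⟨ ∑-distrib-+ {suc n} (𝟙 ∘ atI) (𝟙 ∘ laterNeighbour) ⟩
      sum (𝟙 ∘ atI) + sum (𝟙 ∘ laterNeighbour)
        ≤⟨ +-monoˡ-≤ _ (∑𝟙[toℕ≡ᵇ]≤1 {suc n} m) ⟩
      suc (sum (𝟙 ∘ laterNeighbour))
        ≡⟨ cong suc (∣tabulate∣≡∑𝟙 laterNeighbour) ⟨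
      suc (laterNeighbours G σ i)
        ∎
      where
      open ≤-Reasoning
      atI laterNeighbour δ : Fin (suc n) → Bool
      atI j = toℕ j ≡ᵇ m
      laterNeighbour j = (m <ᵇ toℕ j) ∧ adj G c (σ ⟨$⟩ʳ j)
      δ j = differs (σ ⟨$⟩ʳ j)
      inX-σ : ∀ j → inX (σ ⟨$⟩ʳ j) ≡ atI j ∨ (laterNeighbour j ∧ δ j)
      inX-σ j = cong (λ x → (x ≡ᵇ m) ∨ (((m <ᵇ x) ∧ adj G c (σ ⟨$⟩ʳ j)) ∧ δ j)) (pos-σ j)

    lookup-X : ∀ w → lookup X w ≡ inX w
    lookup-X = lookup∘tabulate inX

    -- does (x ≟ y) and does (x <? y) compute to x ≡ᵇ y and x <ᵇ y.
    c∈X : lookup X c ≡ true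
    c∈X rewrite lookup-X c | dec-true (pos c ≟ m) (pos-σ i) = refl

    earlier∉X : ∀ {w} → pos w < m → lookup X w ≡ false
    earlier∉X {w} w<m rewrite lookup-X w | dec-false (pos w ≟ m) (<⇒≢ w<m)
                            | dec-false (m <? pos w) (<⇒≯ w<m) = refl

    laterNeighbour∈X⇔differs : ∀ {w} → m < pos w → adj G c w ≡ true → lookup X w ≡ differs w
    laterNeighbour∈X⇔differs {w} m<w cw rewrite lookup-X w | dec-false (pos w ≟ m) (>⇒≢ m<w)
                                              | dec-true (m <? pos w) m<w | cw = refl

    pos≡m⇒≡c : ∀ {w} → pos w ≡ m → w ≡ c
    pos≡m⇒≡c w≡m = pos-injective (trans w≡m (sym (pos-σ i)))

    E-oriented : Oriented G E
    E-oriented = invert-oriented X o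

    E-from-c : ∀ v → E c v ≡ D₂ c v
    E-from-c v with <-cmp (pos v) m
    ... | tri< v<m _ _ =
      trans (invert-outsideʳ X D (earlier∉X v<m)) (agreesOnFirst-reverse o agr v<m)
    ... | tri≈ _ v≡m _ = subst (λ w → E c w ≡ D₂ c w) (sym (pos≡m⇒≡c v≡m))
                               (oriented-≡-diagonal E-oriented o₂ c)
    ... | tri> _ _ m<v with adj G c v in cv
    ...   | false = oriented-≡-non-edge E-oriented o₂ cv
    ...   | true  = begin
      E c v                                           ≡⟨ invert-insideˡ X D c∈X ⟩
      (if lookup X v then D v c else D c v)           ≡⟨ cong (λ b → if b then D v c else D c v)
                                                              (laterNeighbour∈X⇔differs m<v cv) ⟩
      (if differs v then D v c else D c v)            ≡⟨ cong (λ d → if differs v then d else D c v)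
                                                              (oriented-reverse-edge o cv) ⟩
      (if differs v then not (D c v) else D c v)      ≡⟨ if-xor-then-not (D c v) (D₂ c v) ⟩
      D₂ c v                                          ∎
      where open ≡-Reasoning

    agreesOnFirst-suc : AgreesOnFirst (suc m) E
    agreesOnFirst-suc u v u<1+m with m<1+n⇒m<n∨m≡n u<1+m
    ... | inj₁ u<m = trans (invert-outsideˡ X D (earlier∉X u<m)) (agr u v u<m)
    ... | inj₂ u≡m = subst (λ w → E w v ≡ D₂ w v) (sym (pos≡m⇒≡c u≡m)) (E-from-c v)

  agreesOnFirst-n⇒≡ : ∀ {D} → Oriented G D → AgreesOnFirst n D → ∀ u v → D u v ≡ D₂ u v
  agreesOnFirst-n⇒≡ {D} o agr u v with pos u <? n | pos v <? n
  ... | yes u<n | _       = agr u v u<n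
  ... | no _    | yes v<n = agreesOnFirst-reverse o agr v<n
  ... | no u≮n  | no v≮n  = subst (λ w → D u w ≡ D₂ u w) u≡v (oriented-≡-diagonal o o₂ u)
    where
    pos≡n : ∀ {w} → ¬ pos w < n → pos w ≡ n
    pos≡n {w} w≮n = ≤-antisym (s≤s⁻¹ (toℕ<n (σ ⟨$⟩ˡ w))) (≮⇒≥ w≮n)
    u≡v : u ≡ v
    u≡v = pos-injective (trans (pos≡n u≮n) (sym (pos≡n v≮n)))

  module _ (p : ℕ) (bound : ∀ i → suc (laterNeighbours G σ i) ≤ p) where

    transformsWithin : ∀ r m → r + m ≡ n → ∀ {D} → Oriented G D → AgreesOnFirst m D →
                       TransformsWithin p r D D₂
    transformsWithin zero    m refl    o agr = [] , z≤n , [] , agreesOnFirst-n⇒≡ o agr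
    transformsWithin (suc r) m 1+r+m≡n {D} o agr =
      invert-∷ X (≤-trans ∣X∣≤1+laterNeighbours (bound i))
        (transformsWithin r (suc m) (trans (+-suc r m) 1+r+m≡n) E-oriented agr′)
      where
      m<1+n : m < suc n
      m<1+n = s≤s (subst (m ≤_) 1+r+m≡n (m≤n+m m (suc r)))
      i : Fin (suc n)
      i = fromℕ< m<1+n
      open Step i o (subst (λ x → AgreesOnFirst x D) (sym (toℕ-fromℕ< m<1+n)) agr)
        using (X; E; ∣X∣≤1+laterNeighbours; E-oriented; agreesOnFirst-suc)
      agr′ : AgreesOnFirst (suc m) E
      agr′ = subst (λ x → AgreesOnFirst (suc x) E) (toℕ-fromℕ< m<1+n) agreesOnFirst-suc

corollary32 : (k n : ℕ) (G : Graph (suc n)) → Degenerate k G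
    → (p : ℕ) → suc k ≤ p → IdLe G p n
corollary32 k n G (σ , degenerate) p k<p D₁ D₂ o₁ o₂ =
  transformsWithin p (λ i → ≤-trans (s≤s (degenerate i)) k<p) n 0 (+-identityʳ n)
    (isOrientation⇒oriented o₁) (λ _ _ ())
  where
  open Orientations G using (isOrientation⇒oriented)
  open Greedy G σ D₂ (isOrientation⇒oriented o₂) using (transformsWithin)
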